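{- Let $\sigma$ be any subsequence (possibly empty) of $e\,w_l\,w_r\,c$. None of the Gentzen systems $\mathcal{FL}_\sigma[\vee,*,0,1]$, $\mathcal{FL}_\sigma[\vee,\wedge,*,0,1]$, $\mathcal{FL}_\sigma[\vee,*,\neg_r,\neg_l,0,1]$, $\mathcal{FL}_\sigma[\vee,\wedge,*,\neg_r,\neg_l,0,1]$ is equivalent to any Hilbert system on the same language; in particular none of them is equivalent to its associated external system.
   Context: Formulas over a language $\Psi\subseteq\{\vee,\wedge,*,\neg_r,\neg_l,0,1\}$ ($\neg_r$ right negation, $\neg_l$ left negation, unary; $\vee,\wedge,*$ binary; $0,1$ constants) are built from countably many variables. A sequent is $\Gamma\Rightarrow\Delta$ with $\Gamma$ a finite (possibly empty) sequence of formulas and $\Delta$ of length at most one ($\emptyset$ = empty sequence). The calculus has axioms $\varphi\Rightarrow\varphi$, $0\Rightarrow\emptyset$, $\emptyset\Rightarrow1$ and rules ($\Gamma,\Pi,\Sigma$ finite sequences, $\Delta$ of length $\le1$): (Cut) from $\Gamma\Rightarrow\varphi$ and $\Sigma,\varphi,\Pi\Rightarrow\Delta$ infer $\Sigma,\Gamma,\Pi\Rightarrow\Delta$; ($\vee\Rightarrow$) from $\Sigma,\varphi,\Gamma\Rightarrow\Delta$ and $\Sigma,\psi,\Gamma\Rightarrow\Delta$ infer $\Sigma,\varphi\vee\psi,\Gamma\Rightarrow\Delta$; ($\Rightarrow\vee$) from $\Gamma\Rightarrow\varphi$ infer $\Gamma\Rightarrow\varphi\vee\psi$ and $\Gamma\Rightarrow\psi\vee\varphi$;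 ($\wedge\Rightarrow$) from $\Sigma,\varphi,\Gamma\Rightarrow\Delta$ infer $\Sigma,\varphi\wedge\psi,\Gamma\Rightarrow\Delta$ and $\Sigma,\psi\wedge\varphi,\Gamma\Rightarrow\Delta$; ($\Rightarrow\wedge$) from $\Gamma\Rightarrow\varphi$, $\Gamma\Rightarrow\psi$ infer $\Gamma\Rightarrow\varphi\wedge\psi$; ($*\Rightarrow$) from $\Sigma,\varphi,\psi,\Gamma\Rightarrow\Delta$ infer $\Sigma,\varphi*\psi,\Gamma\Rightarrow\Delta$; ($\Rightarrow*$) from $\Gamma\Rightarrow\varphi$, $\Pi\Rightarrow\psi$ infer $\Gamma,\Pi\Rightarrow\varphi*\psi$; ($\neg_r\Rightarrow$) from $\Gamma\Rightarrow\varphi$ infer $\Gamma,\neg_r\varphi\Rightarrow\emptyset$; ($\Rightarrow\neg_r$) from $\varphi,\Gamma\Rightarrow\emptyset$ infer $\Gamma\Rightarrow\neg_r\varphi$; ($\neg_l\Rightarrow$) from $\Gamma\Rightarrow\varphi$ infer $\neg_l\varphi,\Gamma\Rightarrow\emptyset$; ($\Rightarrow\neg_l$) from $\Gamma,\varphi\Rightarrow\emptyset$ infer $\Gamma\Rightarrow\neg_l\varphi$; ($1\Rightarrow$) from $\Sigma,\Gamma\Rightarrow\Delta$ infer $\Sigma,1,\Gamma\Rightarrow\Delta$; ($\Rightarrow0$) from $\Gamma\Rightarrow\emptyset$ infer $\Gamma\Rightarrow0$; plus, for each letter of $\sigma$: $e$: from $\Gamma,\varphi,\psi,\Pi\Rightarrow\Delta$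 infer $\Gamma,\psi,\varphi,\Pi\Rightarrow\Delta$; $w_l$: from $\Sigma,\Gamma\Rightarrow\Delta$ infer $\Sigma,\varphi,\Gamma\Rightarrow\Delta$; $w_r$: from $\Gamma\Rightarrow\emptyset$ infer $\Gamma\Rightarrow\varphi$; $c$: from $\Sigma,\varphi,\varphi,\Gamma\Rightarrow\Delta$ infer $\Sigma,\varphi,\Gamma\Rightarrow\Delta$. $\mathcal{FL}_\sigma[\Psi]$ uses only $\Psi$-formulas and only the rules for connectives in $\Psi$ (plus structural rules); $\Phi\vdash\varsigma$ iff there is a finite sequence ending in $\varsigma$ each member of which is an axiom instance, in $\Phi$, or obtained from earlier members by a rule instance. Its external system is the Hilbert system with $\Sigma\vdash\varphi$ iff $\{\emptyset\Rightarrow\psi:\psi\in\Sigma\}\vdash\emptyset\Rightarrow\varphi$. A Hilbert system is a substitution-invariant consequence relation $\vdash_H$ on $\Psi$-formulas. A Gentzen system $\mathcal{G}$ and $\vdash_H$ are equivalent if there are translations $\tau$ from sequents to finite sets of formulas and $\rho$ from formulas to finite sets of sequents, given by schemata in variables, such that $\Phi\vdash_{\mathcal{G}}\varsigma$ iff $\tau[\Phi]\vdash_H\tau(\varsigma)$ for all $\Phi\cup\{\varsigma\}$, and $\varphi$ and $\tau(\rho(\varphi))$ are $\vdash_H$-interderivable for every formula $\varphi$. -}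

module Defs where

open import Data.Bool using (Bool; true; false; T)
open import Data.Nat using (ℕ)
open import Data.Fin using (Fin)
open import Data.List using (List; []; _∷_; _++_; [_]; map; length; lookup)
open import Data.List.Membership.Propositional using (_∈_)
open import Data.Maybe using (Maybe; just; nothing; is-just)
open import Data.Unit using (⊤)
open import Data.Empty using (⊥)
open import Data.Sum using (_⊎_; inj₁; inj₂)
open import Data.Product using (Σ; ∃; _×_; _,_)
open import Relation.Binary.PropositionalEquality using (_≡_)
open import Function.Bundles using (_⇔_)
open import Level using (0ℓ)

record Lang : Set where
  constructor lang
  field
    hasOr hasAnd hasMul hasNegR hasNegL hasZero hasOne : Bool

data Variant : Set where
  [∨*01] [∨∧*01] [∨*¬r¬l01] [∨∧*¬r¬l01] : Variant

langOf : Variant → Lang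
langOf [∨*01]       = lang true false true false false true true
langOf [∨∧*01]      = lang true true  true false false true true
langOf [∨*¬r¬l01]   = lang true false true true  true  true true
langOf [∨∧*¬r¬l01]  = lang true true  true true  true  true true

data Fm (L : Lang) (V : Set) : Set where
  var  : V → Fm L V
  or   : T (Lang.hasOr L)   → Fm L V → Fm L V → Fm L V
  and  : T (Lang.hasAnd L)  → Fm L V → Fm L V → Fm L V
  mul  : T (Lang.hasMul L)  → Fm L V → Fm L V → Fm L V
  negr : T (Lang.hasNegR L) → Fm L V → Fm L V
  negl : T (Lang.hasNegL L) → Fm L V → Fm L V
  zero : T (Lang.hasZero L) → Fm L V
  one  : T (Lang.hasOne L)  → Fm L V

Form : Lang → Set
Form L = Fm L ℕ

sub : ∀ {L V W} → (V → Fm L W) → Fm L V → Fm L W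
sub s (var x)      = s x
sub s (or p a b)   = or p (sub s a) (sub s b)
sub s (and p a b)  = and p (sub s a) (sub s b)
sub s (mul p a b)  = mul p (sub s a) (sub s b)
sub s (negr p a)   = negr p (sub s a)
sub s (negl p a)   = negl p (sub s a)
sub s (zero p)     = zero p
sub s (one p)      = one p

-- Sequents Γ ⇒ Δ, Δ of length ≤ 1 (nothing = ∅).

record Seq (L : Lang) (V : Set) : Set where
  constructor _⇒_
  field
    ante : List (Fm L V)
    succ : Maybe (Fm L V)

infix 4 _⇒_

subSeq : ∀ {L V W} → (V → Fm L W) → Seq L V → Seq L W
subSeq s (Γ ⇒ nothing) = map (sub s) Γ ⇒ nothing
subSeq s (Γ ⇒ just φ)  = map (sub s) Γ ⇒ just (sub s φ)

Sequent : Lang → Set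
Sequent L = Seq L ℕ

record Struct : Set where
  constructor struct
  field
    e wl wr c : Bool

module _ (σ : Struct) (L : Lang) (Φ : Sequent L → Set) where
  open Struct σ

  data Der : Sequent L → Set where
    hyp   : ∀ {ς} → Φ ς → Der ς
    ax    : ∀ φ → Der ([ φ ] ⇒ just φ)
    ax0   : ∀ p → Der ([ zero p ] ⇒ nothing)
    ax1   : ∀ p → Der ([] ⇒ just (one p))
    cut   : ∀ {Γ Σ' Π φ Δ} → Der (Γ ⇒ just φ) → Der (Σ' ++ φ ∷ Π ⇒ Δ) →
            Der (Σ' ++ Γ ++ Π ⇒ Δ)
    or-l  : ∀ {p Σ' Γ φ ψ Δ} → Der (Σ' ++ φ ∷ Γ ⇒ Δ) → Der (Σ' ++ ψ ∷ Γ ⇒ Δ) →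
            Der (Σ' ++ or p φ ψ ∷ Γ ⇒ Δ)
    or-r₁ : ∀ {p Γ φ ψ} → Der (Γ ⇒ just φ) → Der (Γ ⇒ just (or p φ ψ))
    or-r₂ : ∀ {p Γ φ ψ} → Der (Γ ⇒ just φ) → Der (Γ ⇒ just (or p ψ φ))
    and-l₁ : ∀ {p Σ' Γ φ ψ Δ} → Der (Σ' ++ φ ∷ Γ ⇒ Δ) → Der (Σ' ++ and p φ ψ ∷ Γ ⇒ Δ)
    and-l₂ : ∀ {p Σ' Γ φ ψ Δ} → Der (Σ' ++ φ ∷ Γ ⇒ Δ) → Der (Σ' ++ and p ψ φ ∷ Γ ⇒ Δ)
    and-r : ∀ {p Γ φ ψ} → Der (Γ ⇒ just φ) → Der (Γ ⇒ just ψ) →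
            Der (Γ ⇒ just (and p φ ψ))
    mul-l : ∀ {p Σ' Γ φ ψ Δ} → Der (Σ' ++ φ ∷ ψ ∷ Γ ⇒ Δ) →
            Der (Σ' ++ mul p φ ψ ∷ Γ ⇒ Δ)
    mul-r : ∀ {p Γ Π φ ψ} → Der (Γ ⇒ just φ) → Der (Π ⇒ just ψ) →
            Der (Γ ++ Π ⇒ just (mul p φ ψ))
    negr-l : ∀ {p Γ φ} → Der (Γ ⇒ just φ) → Der (Γ ++ [ negr p φ ] ⇒ nothing)
    negr-r : ∀ {p Γ φ} → Der (φ ∷ Γ ⇒ nothing) → Der (Γ ⇒ just (negr p φ))
    negl-l : ∀ {p Γ φ} → Der (Γ ⇒ just φ) → Der (negl p φ ∷ Γ ⇒ nothing)
    negl-r : ∀ {p Γ φ} → Der (Γ ++ [ φ ] ⇒ nothing) → Der (Γ ⇒ just (negl p φ))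
    one-l : ∀ {p Σ' Γ Δ} → Der (Σ' ++ Γ ⇒ Δ) → Der (Σ' ++ one p ∷ Γ ⇒ Δ)
    zero-r : ∀ {p Γ} → Der (Γ ⇒ nothing) → Der (Γ ⇒ just (zero p))
    exch  : ∀ {Γ φ ψ Π Δ} → T e → Der (Γ ++ φ ∷ ψ ∷ Π ⇒ Δ) →
            Der (Γ ++ ψ ∷ φ ∷ Π ⇒ Δ)
    weak-l : ∀ {Σ' Γ φ Δ} → T wl → Der (Σ' ++ Γ ⇒ Δ) → Der (Σ' ++ φ ∷ Γ ⇒ Δ)
    weak-r : ∀ {Γ φ} → T wr → Der (Γ ⇒ nothing) → Der (Γ ⇒ just φ)
    contr : ∀ {Σ' φ Γ Δ} → T c → Der (Σ' ++ φ ∷ φ ∷ Γ ⇒ Δ) →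
            Der (Σ' ++ φ ∷ Γ ⇒ Δ)

FmSet : Lang → Set₁
FmSet L = Form L → Set

_⊆_ : ∀ {L} → FmSet L → FmSet L → Set
X ⊆ Y = ∀ φ → X φ → Y φ

subSet : ∀ {L} → (ℕ → Form L) → FmSet L → FmSet L
subSet s X ψ = ∃ λ χ → X χ × ψ ≡ sub s χ

record HilbertSystem (L : Lang) : Set₁ where
  field
    _⊢_ : FmSet L → Form L → Set
    reflexive  : ∀ {X φ} → X φ → X ⊢ φ
    monotone   : ∀ {X Y φ} → X ⊆ Y → X ⊢ φ → Y ⊢ φ
    transitive : ∀ {X Y φ} → (∀ ψ → Y ψ → X ⊢ ψ) → Y ⊢ φ → X ⊢ φ
    structural : ∀ {X φ} (s : ℕ → Form L) → X ⊢ φ → subSet s X ⊢ sub s φ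

-- Variables of the schema for sequents with n antecedent formulas and
-- succedent of length 1 (b = true) or 0 (b = false).
SchVar : ℕ → Bool → Set
SchVar n b = Fin n ⊎ T b

TauSchema : Lang → Set
TauSchema L = (n : ℕ) (b : Bool) → List (Fm L (SchVar n b))

RhoSchema : Lang → Set
RhoSchema L = List (Seq L ⊤)

instVar : ∀ {L} (Γ : List (Form L)) (Δ : Maybe (Form L)) →
          SchVar (length Γ) (is-just Δ) → Form L
instVar Γ Δ        (inj₁ i) = lookup Γ i
instVar Γ (just ψ) (inj₂ _) = ψ

tau : ∀ {L} → TauSchema L → Sequent L → List (Form L)
tau t (Γ ⇒ Δ) = map (sub (instVar Γ Δ)) (t (length Γ) (is-just Δ))

rho : ∀ {L} → RhoSchema L → Form L → List (Sequent L)
rho r φ = map (subSeq (λ _ → φ)) r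

tauSet : ∀ {L} → TauSchema L → (Sequent L → Set) → FmSet L
tauSet t Φ ψ = ∃ λ ς → Φ ς × ψ ∈ tau t ς

tauRho : ∀ {L} → TauSchema L → RhoSchema L → Form L → FmSet L
tauRho t r φ ψ = ∃ λ ς → ς ∈ rho r φ × ψ ∈ tau t ς

_⊢H[_]_ : ∀ {L} → FmSet L → HilbertSystem L → List (Form L) → Set
X ⊢H[ H ] ψs = ∀ ψ → ψ ∈ ψs → HilbertSystem._⊢_ H X ψ

Equivalent : (σ : Struct) (L : Lang) → HilbertSystem L → Set₁
Equivalent σ L H =
  Σ (TauSchema L) λ t → Σ (RhoSchema L) λ r →
    (∀ (Φ : Sequent L → Set) (ς : Sequent L) →
       Der σ L Φ ς ⇔ (tauSet t Φ ⊢H[ H ] tau t ς))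
  × (∀ φ → (∀ ψ → tauRho t r φ ψ → (λ χ → χ ≡ φ) ⊢ ψ)
         × (tauRho t r φ ⊢ φ))
  where open HilbertSystem H

-- In an equivalence (τ, ρ) every sequent ς is interderivable with ρ[τ(ς)],
-- a set of instances of sequents in one variable.  Take ς = p₀ ⇒ p₁ and the
-- 4-element Gödel chain 0 < α < β < 1 with the valuation w : p₀ ↦ β, p₁ ↦ α.
-- Its homomorphisms lower, middle, upper onto the 3-element chain 0 < ½ < 1
-- (collapsing {α, β}; α ↦ ½ and β ↦ 1; collapsing {α, β, 1}) give three
-- valuations into the 3-element Gödel algebra, where every rule of FL_σ is
-- sound because fusion read as meet is commutative, idempotent and integral.
-- lower ∘ w and upper ∘ w satisfy ς and middle ∘ w does not; but every formula
-- takes under middle ∘ w its value under lower ∘ w or under upper ∘ w, so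
-- middle ∘ w satisfies every one-variable instance derivable from ς, hence
-- all of ρ[τ(ς)], hence ς itself.
module Submission where

open import Defs
open import Data.Product using (Σ; ∃; _×_; _,_; proj₁; proj₂)
open import Relation.Nullary using (¬_; Dec; yes; no)

open import Data.Nat using (ℕ)
open import Data.List using (List; []; _∷_; _++_; [_]; map)
open import Data.List.Membership.Propositional using (_∈_)
open import Data.List.Membership.Propositional.Properties using (∈-map⁻)
open import Data.List.Relation.Unary.Any using (here; there)
open import Data.Maybe using (Maybe; just; nothing)
open import Data.Unit using (⊤)
open import Data.Sum as Sum using (_⊎_; inj₁; inj₂)
open import Function using (_∘_; const; id)
open import Function.Bundles using (Equivalence)
open import Relation.Binary.PropositionalEquality
  using (_≡_; refl; sym; trans; cong; cong₂; subst; module ≡-Reasoning)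
open import Relation.Nullary.Decidable using (from-yes; map′; _×-dec_)

-- Both ∧ and fusion are interpreted by ⊓, both negations by ∼.
record Algebra : Set₁ where
  infixl 7 _⊓_
  infixl 6 _⊔_
  field
    Carrier : Set
    _⊓_ _⊔_ : Carrier → Carrier → Carrier
    ∼_      : Carrier → Carrier
    𝟎 𝟏     : Carrier

module _ (A : Algebra) where
  open Algebra A

  ⟦_⟧ : ∀ {L V} → Fm L V → (V → Carrier) → Carrier
  ⟦ var x     ⟧ v = v x
  ⟦ or _ φ ψ  ⟧ v = ⟦ φ ⟧ v ⊔ ⟦ ψ ⟧ v
  ⟦ and _ φ ψ ⟧ v = ⟦ φ ⟧ v ⊓ ⟦ ψ ⟧ v
  ⟦ mul _ φ ψ ⟧ v = ⟦ φ ⟧ v ⊓ ⟦ ψ ⟧ v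
  ⟦ negr _ φ  ⟧ v = ∼ ⟦ φ ⟧ v
  ⟦ negl _ φ  ⟧ v = ∼ ⟦ φ ⟧ v
  ⟦ zero _    ⟧ v = 𝟎
  ⟦ one _     ⟧ v = 𝟏

  ⟦⟧-sub : ∀ {L V W} (s : V → Fm L W) (φ : Fm L V) (v : W → Carrier) →
           ⟦ sub s φ ⟧ v ≡ ⟦ φ ⟧ (λ x → ⟦ s x ⟧ v)
  ⟦⟧-sub s (var x)     v = refl
  ⟦⟧-sub s (or _ φ ψ)  v = cong₂ _⊔_ (⟦⟧-sub s φ v) (⟦⟧-sub s ψ v)
  ⟦⟧-sub s (and _ φ ψ) v = cong₂ _⊓_ (⟦⟧-sub s φ v) (⟦⟧-sub s ψ v)
  ⟦⟧-sub s (mul _ φ ψ) v = cong₂ _⊓_ (⟦⟧-sub s φ v) (⟦⟧-sub s ψ v)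
  ⟦⟧-sub s (negr _ φ)  v = cong ∼_ (⟦⟧-sub s φ v)
  ⟦⟧-sub s (negl _ φ)  v = cong ∼_ (⟦⟧-sub s φ v)
  ⟦⟧-sub s (zero _)    v = refl
  ⟦⟧-sub s (one _)     v = refl

record IsHomomorphism (A B : Algebra) (f : Algebra.Carrier A → Algebra.Carrier B) : Set where
  private
    module A = Algebra A
    module B = Algebra B
  field
    ⊓-homo : ∀ x y → f (x A.⊓ y) ≡ f x B.⊓ f y
    ⊔-homo : ∀ x y → f (x A.⊔ y) ≡ f x B.⊔ f y
    ∼-homo : ∀ x → f (A.∼ x) ≡ B.∼ f x
    𝟎-homo : f A.𝟎 ≡ B.𝟎
    𝟏-homo : f A.𝟏 ≡ B.𝟏

module _ {A B : Algebra} {f : Algebra.Carrier A → Algebra.Carrier B}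
         (hom : IsHomomorphism A B f) where
  open IsHomomorphism hom
  private
    module A = Algebra A
    module B = Algebra B

  ⟦⟧-homo : ∀ {L V} (φ : Fm L V) (v : V → A.Carrier) → f (⟦ A ⟧ φ v) ≡ ⟦ B ⟧ φ (f ∘ v)
  ⟦⟧-homo (var x)     v = refl
  ⟦⟧-homo (or _ φ ψ)  v = trans (⊔-homo _ _) (cong₂ B._⊔_ (⟦⟧-homo φ v) (⟦⟧-homo ψ v))
  ⟦⟧-homo (and _ φ ψ) v = trans (⊓-homo _ _) (cong₂ B._⊓_ (⟦⟧-homo φ v) (⟦⟧-homo ψ v))
  ⟦⟧-homo (mul _ φ ψ) v = trans (⊓-homo _ _) (cong₂ B._⊓_ (⟦⟧-homo φ v) (⟦⟧-homo ψ v))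
  ⟦⟧-homo (negr _ φ)  v = trans (∼-homo _) (cong B.∼_ (⟦⟧-homo φ v))
  ⟦⟧-homo (negl _ φ)  v = trans (∼-homo _) (cong B.∼_ (⟦⟧-homo φ v))
  ⟦⟧-homo (zero _)    v = 𝟎-homo
  ⟦⟧-homo (one _)     v = 𝟏-homo

⟦⟧-homo-cong : ∀ {A B f g} → IsHomomorphism A B f → IsHomomorphism A B g →
               ∀ {L V} (φ : Fm L V) (v : V → Algebra.Carrier A) →
               f (⟦ A ⟧ φ v) ≡ g (⟦ A ⟧ φ v) → ⟦ B ⟧ φ (f ∘ v) ≡ ⟦ B ⟧ φ (g ∘ v)
⟦⟧-homo-cong f-homo g-homo φ v eq =
  trans (sym (⟦⟧-homo f-homo φ v)) (trans eq (⟦⟧-homo g-homo φ v))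

data G₃ : Set where
  0₃ ½ 1₃ : G₃

infix 4 _≤_
data _≤_ : G₃ → G₃ → Set where
  0≤  : ∀ {a} → 0₃ ≤ a
  ½≤½ : ½ ≤ ½
  ½≤1 : ½ ≤ 1₃
  1≤1 : 1₃ ≤ 1₃

infixl 7 _⊓_
infixl 6 _⊔_

_⊓_ _⊔_ : G₃ → G₃ → G₃
0₃ ⊓ b  = 0₃
½  ⊓ 0₃ = 0₃
½  ⊓ b  = ½
1₃ ⊓ b  = b
0₃ ⊔ b  = b
½  ⊔ 1₃ = 1₃
½  ⊔ b  = ½
1₃ ⊔ b  = 1₃

∼_ : G₃ → G₃
∼ 0₃ = 1₃
∼ _  = 0₃

Gödel₃ : Algebra
Gödel₃ = record
  { Carrier = G₃ ; _⊓_ = _⊓_ ; _⊔_ = _⊔_ ; ∼_ = ∼_ ; 𝟎 = 0₃ ; 𝟏 = 1₃ }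

≤-refl : ∀ {a} → a ≤ a
≤-refl {0₃} = 0≤
≤-refl {½}  = ½≤½
≤-refl {1₃} = 1≤1

≤-reflexive : ∀ {a b} → a ≡ b → a ≤ b
≤-reflexive refl = ≤-refl

≤-trans : ∀ {a b c} → a ≤ b → b ≤ c → a ≤ c
≤-trans 0≤  _   = 0≤
≤-trans ½≤½ q   = q
≤-trans ½≤1 1≤1 = ½≤1
≤-trans 1≤1 q   = q

≤-antisym : ∀ {a b} → a ≤ b → b ≤ a → a ≡ b
≤-antisym 0≤  0≤ = refl
≤-antisym ½≤½ _  = refl
≤-antisym ½≤1 ()
≤-antisym 1≤1 _  = refl

≤-1 : ∀ {a} → a ≤ 1₃
≤-1 {0₃} = 0≤
≤-1 {½}  = ½≤1
≤-1 {1₃} = 1≤1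

⊓-lowerˡ : ∀ a b → a ⊓ b ≤ a
⊓-lowerˡ 0₃ b  = 0≤
⊓-lowerˡ ½  0₃ = 0≤
⊓-lowerˡ ½  ½  = ½≤½
⊓-lowerˡ ½  1₃ = ½≤½
⊓-lowerˡ 1₃ b  = ≤-1

⊓-lowerʳ : ∀ a b → a ⊓ b ≤ b
⊓-lowerʳ 0₃ b  = 0≤
⊓-lowerʳ ½  0₃ = 0≤
⊓-lowerʳ ½  ½  = ½≤½
⊓-lowerʳ ½  1₃ = ½≤1
⊓-lowerʳ 1₃ b  = ≤-refl

⊓-glb : ∀ {a b c} → c ≤ a → c ≤ b → c ≤ a ⊓ b
⊓-glb 0≤  _   = 0≤
⊓-glb ½≤½ ½≤½ = ½≤½
⊓-glb ½≤½ ½≤1 = ½≤½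
⊓-glb ½≤1 ½≤½ = ½≤½
⊓-glb ½≤1 ½≤1 = ½≤1
⊓-glb 1≤1 1≤1 = 1≤1

⊔-upperˡ : ∀ a b → a ≤ a ⊔ b
⊔-upperˡ 0₃ b  = 0≤
⊔-upperˡ ½  0₃ = ½≤½
⊔-upperˡ ½  ½  = ½≤½
⊔-upperˡ ½  1₃ = ½≤1
⊔-upperˡ 1₃ b  = 1≤1

⊔-upperʳ : ∀ a b → b ≤ a ⊔ b
⊔-upperʳ 0₃ b  = ≤-refl
⊔-upperʳ ½  0₃ = 0≤
⊔-upperʳ ½  ½  = ½≤½
⊔-upperʳ ½  1₃ = 1≤1
⊔-upperʳ 1₃ b  = ≤-1

⊔-selective : ∀ a b → a ⊔ b ≤ a ⊎ a ⊔ b ≤ b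
⊔-selective 0₃ b  = inj₂ ≤-refl
⊔-selective ½  0₃ = inj₁ ½≤½
⊔-selective ½  ½  = inj₁ ½≤½
⊔-selective ½  1₃ = inj₂ 1≤1
⊔-selective 1₃ b  = inj₁ 1≤1

∼-intro : ∀ {a c} → c ⊓ a ≤ 0₃ → c ≤ ∼ a
∼-intro {0₃} _ = ≤-1
∼-intro {c = 0₃} _ = 0≤
∼-intro {½}  {½}  ()
∼-intro {½}  {1₃} ()
∼-intro {1₃} {½}  ()
∼-intro {1₃} {1₃} ()

∼-elim : ∀ {a c} → c ≤ a → c ⊓ ∼ a ≤ 0₃
∼-elim 0≤  = 0≤
∼-elim ½≤½ = 0≤
∼-elim ½≤1 = 0≤
∼-elim 1≤1 = 0≤

⊓-mono : ∀ {a a′ b b′} → a ≤ a′ → b ≤ b′ → a ⊓ b ≤ a′ ⊓ b′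
⊓-mono {a} {b = b} p q = ⊓-glb (≤-trans (⊓-lowerˡ a b) p) (≤-trans (⊓-lowerʳ a b) q)

⊓-comm : ∀ a b → a ⊓ b ≡ b ⊓ a
⊓-comm a b = ≤-antisym (⊓-glb (⊓-lowerʳ a b) (⊓-lowerˡ a b))
                       (⊓-glb (⊓-lowerʳ b a) (⊓-lowerˡ b a))

⊓-assoc : ∀ a b c → (a ⊓ b) ⊓ c ≡ a ⊓ (b ⊓ c)
⊓-assoc a b c = ≤-antisym
  (⊓-glb (≤-trans (⊓-lowerˡ _ c) (⊓-lowerˡ a b)) (⊓-mono (⊓-lowerʳ a b) ≤-refl))
  (⊓-glb (⊓-mono ≤-refl (⊓-lowerˡ b c)) (≤-trans (⊓-lowerʳ a _) (⊓-lowerʳ b c)))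

module _ {L : Lang} {V : Set} (v : V → G₃) where

  ⋀ : List (Fm L V) → G₃
  ⋀ []      = 1₃
  ⋀ (φ ∷ Γ) = ⟦ Gödel₃ ⟧ φ v ⊓ ⋀ Γ

  ⋀-++ : ∀ Γ Π → ⋀ (Γ ++ Π) ≡ ⋀ Γ ⊓ ⋀ Π
  ⋀-++ []      Π = refl
  ⋀-++ (φ ∷ Γ) Π = trans (cong (⟦ Gödel₃ ⟧ φ v ⊓_) (⋀-++ Γ Π)) (sym (⊓-assoc _ (⋀ Γ) (⋀ Π)))

  ⋀-∷ʳ : ∀ Γ φ → ⋀ (Γ ++ [ φ ]) ≡ ⋀ Γ ⊓ ⟦ Gödel₃ ⟧ φ v
  ⋀-∷ʳ Γ φ = trans (⋀-++ Γ [ φ ]) (cong (⋀ Γ ⊓_) (⊓-comm _ 1₃))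

  ⋀-mono-infix : ∀ Σ {Γ Γ′} Π → ⋀ Γ ≤ ⋀ Γ′ → ⋀ (Σ ++ Γ ++ Π) ≤ ⋀ (Σ ++ Γ′ ++ Π)
  ⋀-mono-infix []      {Γ} {Γ′} Π p rewrite ⋀-++ Γ Π | ⋀-++ Γ′ Π = ⊓-mono p ≤-refl
  ⋀-mono-infix (φ ∷ Σ) Π p = ⊓-mono ≤-refl (⋀-mono-infix Σ Π p)

  ⋀-member : ∀ {φ Γ} → φ ∈ Γ → ⋀ Γ ≤ ⟦ Gödel₃ ⟧ φ v
  ⋀-member {Γ = ψ ∷ Γ} (here refl) = ⊓-lowerˡ _ (⋀ Γ)
  ⋀-member {Γ = ψ ∷ Γ} (there φ∈) = ≤-trans (⊓-lowerʳ _ (⋀ Γ)) (⋀-member φ∈)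

  ⋀-antitone : ∀ {Γ Γ′} → (∀ {φ} → φ ∈ Γ → φ ∈ Γ′) → ⋀ Γ′ ≤ ⋀ Γ
  ⋀-antitone {[]}    _ = ≤-1
  ⋀-antitone {φ ∷ Γ} Γ⊆Γ′ = ⊓-glb (⋀-member (Γ⊆Γ′ (here refl))) (⋀-antitone (Γ⊆Γ′ ∘ there))

⟦_⟧ˢ : ∀ {L V} → Maybe (Fm L V) → (V → G₃) → G₃
⟦ nothing ⟧ˢ v = 0₃
⟦ just φ  ⟧ˢ v = ⟦ Gödel₃ ⟧ φ v

infix 4 _⊨_
_⊨_ : ∀ {L V} → (V → G₃) → Seq L V → Set
v ⊨ (Γ ⇒ Δ) = ⋀ v Γ ≤ ⟦ Δ ⟧ˢ v

module _ {L : Lang} {σ : Struct} {Φ : Sequent L → Set} (v : ℕ → G₃) where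

  private
    ⟦_⟧ᵛ : Form L → G₃
    ⟦ φ ⟧ᵛ = ⟦ Gödel₃ ⟧ φ v

  ⋀-replace-infix : ∀ (Σ Γ Γ′ Π : List (Form L)) {d} → ⋀ v Γ′ ≤ ⋀ v Γ →
                    ⋀ v (Σ ++ Γ ++ Π) ≤ d → ⋀ v (Σ ++ Γ′ ++ Π) ≤ d
  ⋀-replace-infix Σ Γ Γ′ Π p ⊨Γ = ≤-trans (⋀-mono-infix v Σ Π p) ⊨Γ

  sound : (∀ ς → Φ ς → v ⊨ ς) → ∀ {ς} → Der σ L Φ ς → v ⊨ ς
  sound ⊨Φ (hyp ς∈Φ) = ⊨Φ _ ς∈Φ
  sound ⊨Φ (ax φ)    = ⊓-lowerˡ ⟦ φ ⟧ᵛ 1₃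
  sound ⊨Φ (ax0 _)   = 0≤
  sound ⊨Φ (ax1 _)   = 1≤1
  sound ⊨Φ (cut {Γ} {Σ} {Π} ⊢φ ⊢Δ) =
    ⋀-replace-infix Σ [ _ ] Γ Π (⊓-glb (sound ⊨Φ ⊢φ) ≤-1) (sound ⊨Φ ⊢Δ)
  sound ⊨Φ (or-l {Σ' = Σ} {Γ} {φ} {ψ} ⊢φ ⊢ψ) with ⊔-selective ⟦ φ ⟧ᵛ ⟦ ψ ⟧ᵛ
  ... | inj₁ ≤φ = ⋀-replace-infix Σ [ φ ] [ _ ] Γ (⊓-mono ≤φ ≤-refl) (sound ⊨Φ ⊢φ)
  ... | inj₂ ≤ψ = ⋀-replace-infix Σ [ ψ ] [ _ ] Γ (⊓-mono ≤ψ ≤-refl) (sound ⊨Φ ⊢ψ)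
  sound ⊨Φ (or-r₁ {φ = φ} {ψ} d) = ≤-trans (sound ⊨Φ d) (⊔-upperˡ ⟦ φ ⟧ᵛ ⟦ ψ ⟧ᵛ)
  sound ⊨Φ (or-r₂ {φ = φ} {ψ} d) = ≤-trans (sound ⊨Φ d) (⊔-upperʳ ⟦ ψ ⟧ᵛ ⟦ φ ⟧ᵛ)
  sound ⊨Φ (and-l₁ {Σ' = Σ} {Γ} {φ} {ψ} d) =
    ⋀-replace-infix Σ [ φ ] [ _ ] Γ (⊓-mono (⊓-lowerˡ ⟦ φ ⟧ᵛ ⟦ ψ ⟧ᵛ) ≤-refl) (sound ⊨Φ d)
  sound ⊨Φ (and-l₂ {Σ' = Σ} {Γ} {φ} {ψ} d) =
    ⋀-replace-infix Σ [ φ ] [ _ ] Γ (⊓-mono (⊓-lowerʳ ⟦ ψ ⟧ᵛ ⟦ φ ⟧ᵛ) ≤-refl) (sound ⊨Φ d)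
  sound ⊨Φ (and-r d e) = ⊓-glb (sound ⊨Φ d) (sound ⊨Φ e)
  sound ⊨Φ (mul-l {Σ' = Σ} {Γ} {φ} {ψ} d) =
    ⋀-replace-infix Σ (φ ∷ ψ ∷ []) [ _ ] Γ (≤-reflexive (⊓-assoc ⟦ φ ⟧ᵛ ⟦ ψ ⟧ᵛ 1₃)) (sound ⊨Φ d)
  sound ⊨Φ (mul-r {Γ = Γ} {Π} d e) =
    subst (_≤ _) (sym (⋀-++ v Γ Π)) (⊓-mono (sound ⊨Φ d) (sound ⊨Φ e))
  sound ⊨Φ (negr-l {Γ = Γ} d) =
    subst (_≤ 0₃) (sym (⋀-∷ʳ v Γ _)) (∼-elim (sound ⊨Φ d))
  sound ⊨Φ (negr-r {Γ = Γ} {φ} d) =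
    ∼-intro (subst (_≤ 0₃) (⊓-comm ⟦ φ ⟧ᵛ (⋀ v Γ)) (sound ⊨Φ d))
  sound ⊨Φ (negl-l {Γ = Γ} {φ} d) =
    subst (_≤ 0₃) (⊓-comm (⋀ v Γ) (∼ ⟦ φ ⟧ᵛ)) (∼-elim (sound ⊨Φ d))
  sound ⊨Φ (negl-r {Γ = Γ} {φ} d) =
    ∼-intro (subst (_≤ 0₃) (⋀-∷ʳ v Γ φ) (sound ⊨Φ d))
  sound ⊨Φ (one-l {Σ' = Σ} {Γ} d) = ⋀-replace-infix Σ [] [ _ ] Γ ≤-refl (sound ⊨Φ d)
  sound ⊨Φ (zero-r d) = sound ⊨Φ d
  sound ⊨Φ (exch {Γ = Σ} {φ} {ψ} {Π} _ d) =
    ⋀-replace-infix Σ (φ ∷ ψ ∷ []) (ψ ∷ φ ∷ []) Π (⋀-antitone v swap) (sound ⊨Φ d)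
    where
    swap : ∀ {χ} → χ ∈ φ ∷ ψ ∷ [] → χ ∈ ψ ∷ φ ∷ []
    swap (here refl)         = there (here refl)
    swap (there (here refl)) = here refl
  sound ⊨Φ (weak-l {Σ' = Σ} {Γ} _ d) = ⋀-replace-infix Σ [] [ _ ] Γ ≤-1 (sound ⊨Φ d)
  sound ⊨Φ (weak-r _ d) = ≤-trans (sound ⊨Φ d) 0≤
  sound ⊨Φ (contr {Σ' = Σ} {φ} {Γ} _ d) =
    ⋀-replace-infix Σ (φ ∷ φ ∷ []) [ φ ] Γ (⋀-antitone v duplicate) (sound ⊨Φ d)
    where
    duplicate : ∀ {χ} → χ ∈ φ ∷ φ ∷ [] → χ ∈ [ φ ]
    duplicate (here refl)         = here refl
    duplicate (there (here refl)) = here refl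

data G₄ : Set where
  0₄ α β 1₄ : G₄

infixl 7 _⊓₄_
infixl 6 _⊔₄_

_⊓₄_ _⊔₄_ : G₄ → G₄ → G₄
0₄ ⊓₄ b  = 0₄
α  ⊓₄ 0₄ = 0₄
α  ⊓₄ b  = α
β  ⊓₄ 1₄ = β
β  ⊓₄ b  = b
1₄ ⊓₄ b  = b
0₄ ⊔₄ b  = b
α  ⊔₄ 0₄ = α
α  ⊔₄ b  = b
β  ⊔₄ 1₄ = 1₄
β  ⊔₄ b  = β
1₄ ⊔₄ b  = 1₄

∼₄_ : G₄ → G₄
∼₄ 0₄ = 1₄
∼₄ _  = 0₄

Gödel₄ : Algebra
Gödel₄ = record
  { Carrier = G₄ ; _⊓_ = _⊓₄_ ; _⊔_ = _⊔₄_ ; ∼_ = ∼₄_ ; 𝟎 = 0₄ ; 𝟏 = 1₄ }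

infix 4 _≟_
_≟_ : (a b : G₃) → Dec (a ≡ b)
0₃ ≟ 0₃ = yes refl
0₃ ≟ ½  = no λ ()
0₃ ≟ 1₃ = no λ ()
½  ≟ 0₃ = no λ ()
½  ≟ ½  = yes refl
½  ≟ 1₃ = no λ ()
1₃ ≟ 0₃ = no λ ()
1₃ ≟ ½  = no λ ()
1₃ ≟ 1₃ = yes refl

all₄? : {P : G₄ → Set} → (∀ x → Dec (P x)) → Dec (∀ x → P x)
all₄? P? = map′ (λ (p₀ , pα , pβ , p₁) → λ { 0₄ → p₀ ; α → pα ; β → pβ ; 1₄ → p₁ })
                (λ p → p 0₄ , p α , p β , p 1₄)
                (P? 0₄ ×-dec P? α ×-dec P? β ×-dec P? 1₄)

isHomomorphism? : (f : G₄ → G₃) → f 0₄ ≡ 0₃ → f 1₄ ≡ 1₃ →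
                  Dec (IsHomomorphism Gödel₄ Gödel₃ f)
isHomomorphism? f f0 f1 = map′
  (λ (⊓-homo , ⊔-homo , ∼-homo) → record
    { ⊓-homo = ⊓-homo ; ⊔-homo = ⊔-homo ; ∼-homo = ∼-homo ; 𝟎-homo = f0 ; 𝟏-homo = f1 })
  (λ hom → let open IsHomomorphism hom in ⊓-homo , ⊔-homo , ∼-homo)
  (      all₄? (λ x → all₄? λ y → f (x ⊓₄ y) ≟ f x ⊓ f y)
   ×-dec all₄? (λ x → all₄? λ y → f (x ⊔₄ y) ≟ f x ⊔ f y)
   ×-dec all₄? (λ x → f (∼₄ x) ≟ ∼ f x))

lower middle upper : G₄ → G₃
lower 0₄ = 0₃
lower α  = ½
lower β  = ½
lower 1₄ = 1₃
middle 0₄ = 0₃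
middle α  = ½
middle β  = 1₃
middle 1₄ = 1₃
upper 0₄ = 0₃
upper α  = 1₃
upper β  = 1₃
upper 1₄ = 1₃

lower-homo : IsHomomorphism Gödel₄ Gödel₃ lower
lower-homo = from-yes (isHomomorphism? lower refl refl)

middle-homo : IsHomomorphism Gödel₄ Gödel₃ middle
middle-homo = from-yes (isHomomorphism? middle refl refl)

upper-homo : IsHomomorphism Gödel₄ Gödel₃ upper
upper-homo = from-yes (isHomomorphism? upper refl refl)

middle≡lower⊎upper : ∀ x → middle x ≡ lower x ⊎ middle x ≡ upper x
middle≡lower⊎upper 0₄ = inj₁ refl
middle≡lower⊎upper α  = inj₁ refl
middle≡lower⊎upper β  = inj₂ refl
middle≡lower⊎upper 1₄ = inj₁ refl

⟦⟧-middle : ∀ {L V} (w : V → G₄) (χ : Fm L V) →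
            ⟦ Gödel₃ ⟧ χ (middle ∘ w) ≡ ⟦ Gödel₃ ⟧ χ (lower ∘ w)
          ⊎ ⟦ Gödel₃ ⟧ χ (middle ∘ w) ≡ ⟦ Gödel₃ ⟧ χ (upper ∘ w)
⟦⟧-middle w χ = Sum.map (⟦⟧-homo-cong middle-homo lower-homo χ w)
                        (⟦⟧-homo-cong middle-homo upper-homo χ w)
                        (middle≡lower⊎upper (⟦ Gödel₄ ⟧ χ w))

⋀-sub : ∀ {L V W} (v : W → G₃) (s : V → Fm L W) (Γ : List (Fm L V)) →
        ⋀ v (map (sub s) Γ) ≡ ⋀ (λ x → ⟦ Gödel₃ ⟧ (s x) v) Γ
⋀-sub v s []      = refl
⋀-sub v s (φ ∷ Γ) = cong₂ _⊓_ (⟦⟧-sub Gödel₃ s φ v) (⋀-sub v s Γ)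

⊨-sub : ∀ {L V W} (v : W → G₃) (s : V → Fm L W) (ς : Seq L V) →
        (v ⊨ subSeq s ς) ≡ ((λ x → ⟦ Gödel₃ ⟧ (s x) v) ⊨ ς)
⊨-sub v s (Γ ⇒ nothing) = cong (_≤ 0₃) (⋀-sub v s Γ)
⊨-sub v s (Γ ⇒ just φ)  = cong₂ _≤_ (⋀-sub v s Γ) (⟦⟧-sub Gödel₃ s φ v)

⊨-instance-cong : ∀ {L} {v v′ : ℕ → G₃} (χ : Form L) (ς : Seq L ⊤) →
                  ⟦ Gödel₃ ⟧ χ v ≡ ⟦ Gödel₃ ⟧ χ v′ →
                  (v ⊨ subSeq (const χ) ς) ≡ (v′ ⊨ subSeq (const χ) ς)
⊨-instance-cong {v = v} {v′} χ ς eq = begin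
  v  ⊨ subSeq (const χ) ς           ≡⟨ ⊨-sub v (const χ) ς ⟩
  const (⟦ Gödel₃ ⟧ χ v)  ⊨ ς       ≡⟨ cong (λ a → const a ⊨ ς) eq ⟩
  const (⟦ Gödel₃ ⟧ χ v′) ⊨ ς       ≡⟨ sym (⊨-sub v′ (const χ) ς) ⟩
  v′ ⊨ subSeq (const χ) ς           ∎
  where open ≡-Reasoning

module _ {σ : Struct} {L : Lang} (H : HilbertSystem L) (equivalence : Equivalent σ L H) where
  open HilbertSystem H
  private
    t = proj₁ equivalence
    r = proj₁ (proj₂ equivalence)
    faithful = proj₁ (proj₂ (proj₂ equivalence))
    τρ-interderivable = proj₂ (proj₂ (proj₂ equivalence))

  ρ[τ_] : Sequent L → Sequent L → Set
  ρ[τ ς ] s = ∃ λ χ → χ ∈ tau t ς × s ∈ rho r χ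

  ρτ⊢ : ∀ ς → Der σ L ρ[τ ς ] ς
  ρτ⊢ ς = Equivalence.from (faithful ρ[τ ς ] ς) λ χ χ∈τς →
    monotone (λ { ψ (s , s∈ρχ , ψ∈τs) → s , (χ , χ∈τς , s∈ρχ) , ψ∈τs })
             (proj₂ (τρ-interderivable χ))

  ⊢ρτ : ∀ ς {s} → ρ[τ ς ] s → Der σ L (_≡ ς) s
  ⊢ρτ ς {s} (χ , χ∈τς , s∈ρχ) = Equivalence.from (faithful (_≡ ς) s) λ ψ ψ∈τs →
    transitive (λ { _ refl → reflexive (ς , refl , χ∈τς) })
               (proj₁ (τρ-interderivable χ) ψ (s , s∈ρχ , ψ∈τs))

p₀⇒p₁ : ∀ {L} → Sequent L
p₀⇒p₁ = [ var 0 ] ⇒ just (var 1)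

w : ℕ → G₄
w 0 = β
w 1 = α
w _ = 0₄

middle∘w-validates : ∀ {σ L} {r : RhoSchema L} {ς} (χ : Form L) → ς ∈ rho r χ →
                     Der σ L (_≡ p₀⇒p₁) ς → middle ∘ w ⊨ ς
middle∘w-validates χ ς∈ρχ ⊢ς with ∈-map⁻ (subSeq (const χ)) ς∈ρχ
... | ς₀ , _ , refl with ⟦⟧-middle w χ
...   | inj₁ eq = subst id (sym (⊨-instance-cong χ ς₀ eq))
                        (sound (lower ∘ w) (λ { _ refl → ½≤½ }) ⊢ς)
...   | inj₂ eq = subst id (sym (⊨-instance-cong χ ς₀ eq))
                        (sound (upper ∘ w) (λ { _ refl → 1≤1 }) ⊢ς)

no-equivalent-hilbert-system : ∀ σ L (H : HilbertSystem L) → ¬ Equivalent σ L H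
no-equivalent-hilbert-system σ L H equivalence = middle∘w-refutes
  (sound (middle ∘ w) middle∘w⊨ρτ (ρτ⊢ H equivalence p₀⇒p₁))
  where
  middle∘w-refutes : ¬ (middle ∘ w ⊨ p₀⇒p₁ {L})
  middle∘w-refutes ()

  middle∘w⊨ρτ : ∀ ς → ρ[τ_] H equivalence p₀⇒p₁ ς → middle ∘ w ⊨ ς
  middle∘w⊨ρτ _ ρτς@(χ , _ , ς∈ρχ) = middle∘w-validates χ ς∈ρχ (⊢ρτ H equivalence p₀⇒p₁ ρτς)

corollary33 : (σ : Struct) (v : Variant) →
    ¬ (Σ (HilbertSystem (langOf v)) λ H → Equivalent σ (langOf v) H)
corollary33 σ v (H , equivalence) = no-equivalent-hilbert-system σ (langOf v) H equivalence
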